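{- Let $k,\ell\ge0$ be integers with $k+\ell\ge3$. Then $\langle\{\mathrm{Compl}_{k,\ell}\}\rangle_{\max}=IN_2$, the set of all self-complement relations on $\{0,1\}$.
   Context: $\mathrm{Compl}_{k,\ell}$ is the $(k+\ell)$-ary relation $\{0,1\}^{k+\ell}\setminus\{(0,\dots,0,1,\dots,1),(1,\dots,1,0,\dots,0)\}$, where the first excluded tuple has $k$ zeros followed by $\ell$ ones and the second has $k$ ones followed by $\ell$ zeros. A relation is self-complement if with every tuple it contains the tuple with all entries flipped. Max-implementation: for an $(n+m)$-ary $R$, $\exists_{\max}(y_1,\dots,y_m)R$ consists of those $\mathbf a\in\{0,1\}^n$ whose number of extensions $\mathbf b\in\{0,1\}^m$ with $(\mathbf a,\mathbf b)\in R$ is maximal over all of $\{0,1\}^n$. $\langle\Gamma\rangle_{\max}$ is the smallest set containing $\Gamma$ and $\mathrm{EQ}=\{(0,0),(1,1)\}$, closed under manipulations with variables (renaming, permuting, identifying variables), conjunction and max-implementation. -}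

module Defs where

open import Data.Bool using (Bool; true; false; not; _∧_; if_then_else_)
open import Data.Nat using (ℕ; zero; suc; _+_; _⊔_; _≡ᵇ_)
open import Data.Fin using (Fin)
open import Data.Vec using (Vec; []; _∷_; _++_; take; drop; replicate; tabulate; lookup; map)
open import Data.List as List using (List)
open import Relation.Binary.PropositionalEquality using (_≡_)
open import Data.Nat.ListAction using (sum)

-- A tuple of arity n over {0,1} (false = 0, true = 1).
Tuple : ℕ → Set
Tuple n = Vec Bool n

Rel : ℕ → Set
Rel n = Tuple n → Bool

allTuples : (n : ℕ) → List (Tuple n)
allTuples zero = List.[ [] ]
allTuples (suc n) =
  List.map (false ∷_) (allTuples n) List.++ List.map (true ∷_) (allTuples n)

eqTuple : ∀ {n} → Tuple n → Tuple n → Bool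
eqTuple [] [] = true
eqTuple (false ∷ u) (false ∷ v) = eqTuple u v
eqTuple (true ∷ u) (true ∷ v) = eqTuple u v
eqTuple (false ∷ u) (true ∷ v) = false
eqTuple (true ∷ u) (false ∷ v) = false

EQ : Rel 2
EQ (a ∷ b ∷ []) = if a then b else not b

Compl : (k l : ℕ) → Rel (k + l)
Compl k l v =
  not (eqTuple v (replicate k false ++ replicate l true)) ∧
  not (eqTuple v (replicate k true ++ replicate l false))

-- Self-complement relations (the set IN_2).
SelfComplement : ∀ {n} → Rel n → Set
SelfComplement {n} R = (v : Tuple n) → R v ≡ true → R (map not v) ≡ true

-- Manipulation with variables: R'(x_1..x_m) = R(x_{σ 1}, ..., x_{σ n}).
-- (covers renaming, permuting and identifying variables)
reindex : ∀ {n m} → (Fin n → Fin m) → Rel n → Rel m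
reindex {n} σ R v = R (tabulate (λ i → lookup v (σ i)))

conjRel : ∀ {n m} → Rel n → Rel m → Rel (n + m)
conjRel {n} R S v = R (take n v) ∧ S (drop n v)

countExt : ∀ {n} m → Rel (n + m) → Tuple n → ℕ
countExt m R a = sum (List.map (λ b → if R (a ++ b) then 1 else 0) (allTuples m))

maxExt : ∀ n m → Rel (n + m) → ℕ
maxExt n m R = List.foldr _⊔_ 0 (List.map (countExt m R) (allTuples n))

maxImpl : ∀ n m → Rel (n + m) → Rel n
maxImpl n m R a = countExt m R a ≡ᵇ maxExt n m R

-- Relations are sets of tuples, so membership is up to extensional equality.
data MaxClosure (Γ : (n : ℕ) → Rel n → Set) : (n : ℕ) → Rel n → Set where
  gen    : ∀ {n R} → Γ n R → MaxClosure Γ n R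
  eq     : MaxClosure Γ 2 EQ
  vars   : ∀ {n m R} (σ : Fin n → Fin m) → MaxClosure Γ n R → MaxClosure Γ m (reindex σ R)
  conj   : ∀ {n m R S} → MaxClosure Γ n R → MaxClosure Γ m S → MaxClosure Γ (n + m) (conjRel R S)
  maxImp : ∀ {n m R} → MaxClosure Γ (n + m) R → MaxClosure Γ n (maxImpl n m R)
  ext    : ∀ {n R S} → MaxClosure Γ n R → ((v : Tuple n) → R v ≡ S v) → MaxClosure Γ n S

data IsCompl (k l : ℕ) : (n : ℕ) → Rel n → Set where
  here : IsCompl k l (k + l) (Compl k l)

module Submission where

-- Call R invariant when R (∁ v) = R v for
-- every tuple v (∁ = bitwise complement) and let Excl a = {0,1}ⁿ ∖ {a, ∁ a};
-- then Compl_{k,ℓ} = Excl (0ᵏ1ˡ) and NAE₃ = Excl (111).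
--
-- Soundness: EQ and every Excl a are invariant and each closure operation
-- preserves invariance (for max-implementation because complementing the
-- extension variables permutes them, so a and ∁ a have equally many
-- extensions).  Completeness: (1) identifying variables of Compl_{k,ℓ}
-- yields a 3-ary Excl and from it NAE₃; (2) from NAE₃ every Excl a with a
-- nonempty is built by gadgets whose max-implementations have at most one
-- extension per tuple and hence act as existential quantifiers; (3) an
-- invariant R is the conjunction of the Excl a over the tuples a ∉ R.

open import Defs
open import Data.Bool using (Bool; true; false; not; _∧_; if_then_else_)
open import Data.Bool.Properties using (not-involutive; ∧-comm; ⇔→≡) renaming (_≟_ to _≟ᵇ_)
open import Data.Empty using (⊥; ⊥-elim)
open import Data.Fin using (Fin; zero; suc; _↑ˡ_; _↑ʳ_; #_)
open import Data.List as List using (List)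
open import Data.List.Membership.Propositional using (_∈_)
open import Data.List.Membership.Propositional.Properties using (∈-map⁺; ∈-++⁺ˡ; ∈-++⁺ʳ)
import Data.List.Properties as List
open import Data.List.Relation.Unary.All as All using (all?)
open import Data.List.Relation.Unary.Any using (here; there)
open import Data.Nat using (ℕ; zero; suc; _+_; _⊔_; _≡ᵇ_; _≤_; z≤n; s≤s)
open import Data.Nat.ListAction using (sum)
open import Data.Nat.ListAction.Properties using (sum-++)
open import Data.Nat.Properties using (+-comm; ⊔-lub; m≤m⊔n; m≤n⊔m; ≤-trans; ≤-antisym) renaming (_≟_ to _≟ℕ_)
open import Data.Product using (∃; _,_)
open import Data.Vec using ([]; _∷_; _++_; take; drop; replicate; tabulate; lookup; map)
open import Data.Vec.Properties
  using ( lookup-map; map-++; map-replicate; map-const; take-map; drop-map; take++drop≡id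
        ; ++-injectiveˡ; ++-injectiveʳ; tabulate-cong; tabulate-∘; tabulate∘lookup; lookup∘tabulate
        ; lookup-++ˡ; lookup-++ʳ; lookup-replicate)
open import Function using (_∘_; id; const)
open import Function.Bundles using (_⇔_; mk⇔)
open import Relation.Binary.PropositionalEquality
open import Relation.Nullary using (Dec)
open import Relation.Nullary.Decidable using (True; toWitness; from-yes; map′; _→-dec_; _×-dec_)

∁ : ∀ {n} → Tuple n → Tuple n
∁ = map not

∁-involutive : ∀ {n} (v : Tuple n) → ∁ (∁ v) ≡ v
∁-involutive []      = refl
∁-involutive (b ∷ v) = cong₂ _∷_ (not-involutive b) (∁-involutive v)

eqTuple-refl : ∀ {n} (v : Tuple n) → eqTuple v v ≡ true
eqTuple-refl []          = refl
eqTuple-refl (true ∷ v)  = eqTuple-refl v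
eqTuple-refl (false ∷ v) = eqTuple-refl v

eqTuple-sound : ∀ {n} (u v : Tuple n) → eqTuple u v ≡ true → u ≡ v
eqTuple-sound []          []          _ = refl
eqTuple-sound (true ∷ u)  (true ∷ v)  e = cong (true ∷_) (eqTuple-sound u v e)
eqTuple-sound (false ∷ u) (false ∷ v) e = cong (false ∷_) (eqTuple-sound u v e)

eqTuple-∁ : ∀ {n} (u w : Tuple n) → eqTuple (∁ u) w ≡ eqTuple u (∁ w)
eqTuple-∁ []          []          = refl
eqTuple-∁ (false ∷ u) (false ∷ w) = refl
eqTuple-∁ (false ∷ u) (true ∷ w)  = eqTuple-∁ u w
eqTuple-∁ (true ∷ u)  (false ∷ w) = eqTuple-∁ u w
eqTuple-∁ (true ∷ u)  (true ∷ w)  = refl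

eqTuple-∁-self : ∀ {n} (u : Tuple (suc n)) → eqTuple u (∁ u) ≡ false
eqTuple-∁-self (true ∷ u)  = refl
eqTuple-∁-self (false ∷ u) = refl

eqTuple-notBoth : ∀ {n} (x a : Tuple (suc n)) → eqTuple x a ∧ eqTuple x (∁ a) ≡ false
eqTuple-notBoth x a with eqTuple x a in e
... | false = refl
... | true = subst (λ w → eqTuple w (∁ a) ≡ false) (sym (eqTuple-sound x a e)) (eqTuple-∁-self a)

eqTuple-++ : ∀ {k n} (u p : Tuple k) (x a : Tuple n) →
  eqTuple (u ++ x) (p ++ a) ≡ eqTuple u p ∧ eqTuple x a
eqTuple-++ []          []          x a = refl
eqTuple-++ (true ∷ u)  (true ∷ p)  x a = eqTuple-++ u p x a
eqTuple-++ (true ∷ u)  (false ∷ p) x a = refl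
eqTuple-++ (false ∷ u) (true ∷ p)  x a = refl
eqTuple-++ (false ∷ u) (false ∷ p) x a = eqTuple-++ u p x a

Excl : ∀ {n} → Tuple n → Rel n
Excl a v = not (eqTuple v a) ∧ not (eqTuple v (∁ a))

NAE₃ : Rel 3
NAE₃ = Excl (true ∷ true ∷ true ∷ [])

Excl-∁ : ∀ {n} (a v : Tuple n) → Excl (∁ a) v ≡ Excl a v
Excl-∁ a v = begin
  not (eqTuple v (∁ a)) ∧ not (eqTuple v (∁ (∁ a))) ≡⟨ cong (λ w → not (eqTuple v (∁ a)) ∧ not (eqTuple v w)) (∁-involutive a) ⟩
  not (eqTuple v (∁ a)) ∧ not (eqTuple v a)         ≡⟨ ∧-comm (not (eqTuple v (∁ a))) _ ⟩
  Excl a v                                          ∎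
  where open ≡-Reasoning

Excl-invariant : ∀ {n} (a v : Tuple n) → Excl a (∁ v) ≡ Excl a v
Excl-invariant a v = begin
  not (eqTuple (∁ v) a) ∧ not (eqTuple (∁ v) (∁ a)) ≡⟨ cong₂ (λ x y → not x ∧ not y) (eqTuple-∁ v a) (eqTuple-∁ v (∁ a)) ⟩
  Excl (∁ a) v                                      ≡⟨ Excl-∁ a v ⟩
  Excl a v                                          ∎
  where open ≡-Reasoning

Excl-self : ∀ {n} (a : Tuple n) → Excl a a ≡ false
Excl-self a rewrite eqTuple-refl a = refl

Excl-outside : ∀ {n} (a v : Tuple n) → v ≢ a → v ≢ ∁ a → Excl a v ≡ true
Excl-outside a v v≢a v≢∁a with eqTuple v a in e₁ | eqTuple v (∁ a) in e₂
... | true  | _     = ⊥-elim (v≢a (eqTuple-sound v a e₁))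
... | false | true  = ⊥-elim (v≢∁a (eqTuple-sound v (∁ a) e₂))
... | false | false = refl

Excl-flipHead : ∀ {n} (b : Bool) (w : Tuple (suc n)) → Excl (b ∷ w) (not b ∷ w) ≡ true
Excl-flipHead true  w = cong not (eqTuple-∁-self w)
Excl-flipHead false w = cong not (eqTuple-∁-self w)

-- Excl on a concatenation, with the second block seen only through the two
-- flags E = [x = a] and E' = [x = ∁ a].
ExclOn : ∀ {k} → Tuple k → Tuple k → Bool → Bool → Bool
ExclOn p u E E' = not (eqTuple u p ∧ E) ∧ not (eqTuple u (∁ p) ∧ E')

Excl-++ : ∀ {k n} (p u : Tuple k) (a x : Tuple n) →
  Excl (p ++ a) (u ++ x) ≡ ExclOn p u (eqTuple x a) (eqTuple x (∁ a))
Excl-++ p u a x = begin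
  not (eqTuple (u ++ x) (p ++ a)) ∧ not (eqTuple (u ++ x) (∁ (p ++ a)))
    ≡⟨ cong (λ w → not (eqTuple (u ++ x) (p ++ a)) ∧ not (eqTuple (u ++ x) w)) (map-++ not p a) ⟩
  not (eqTuple (u ++ x) (p ++ a)) ∧ not (eqTuple (u ++ x) (∁ p ++ ∁ a))
    ≡⟨ cong₂ (λ s t → not s ∧ not t) (eqTuple-++ u p x a) (eqTuple-++ u (∁ p) x (∁ a)) ⟩
  ExclOn p u (eqTuple x a) (eqTuple x (∁ a)) ∎
  where open ≡-Reasoning

Compl-Excl : ∀ k l (v : Tuple (k + l)) → Compl k l v ≡ Excl (replicate k false ++ replicate l true) v
Compl-Excl k l v = cong (λ w → not (eqTuple v (replicate k false ++ replicate l true)) ∧ not (eqTuple v w))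
  (sym (trans (map-++ not (replicate k false) (replicate l true))
              (cong₂ _++_ (map-replicate not false k) (map-replicate not true l))))

-- Soundness: the closure consists of invariant relations

-- Invariance under complementation; for Boolean relations equivalent to
-- self-complementarity.
Invariant : ∀ {n} → Rel n → Set
Invariant {n} R = (v : Tuple n) → R (∁ v) ≡ R v

invariant⇒selfComplement : ∀ {n} {R : Rel n} → Invariant R → SelfComplement R
invariant⇒selfComplement inv v Rv = trans (inv v) Rv

selfComplement⇒invariant : ∀ {n} {R : Rel n} → SelfComplement R → Invariant R
selfComplement⇒invariant {R = R} sc v = ⇔→≡ {z = true} (mk⇔ from-∁ (sc v))
  where
  from-∁ : R (∁ v) ≡ true → R v ≡ true
  from-∁ R∁v = subst (λ w → R w ≡ true) (∁-involutive v) (sc (∁ v) R∁v)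

EQ-invariant : Invariant EQ
EQ-invariant (false ∷ false ∷ []) = refl
EQ-invariant (false ∷ true ∷ [])  = refl
EQ-invariant (true ∷ false ∷ [])  = refl
EQ-invariant (true ∷ true ∷ [])   = refl

pull : ∀ {n m} → (Fin n → Fin m) → Tuple m → Tuple n
pull σ v = tabulate (λ i → lookup v (σ i))

pull-∁ : ∀ {n m} (σ : Fin n → Fin m) (v : Tuple m) → pull σ (∁ v) ≡ ∁ (pull σ v)
pull-∁ σ v = trans (tabulate-cong (λ i → lookup-map (σ i) not v)) (tabulate-∘ not (lookup v ∘ σ))

sumTuples : ∀ m → (Tuple m → ℕ) → ℕ
sumTuples m f = sum (List.map f (allTuples m))

sumTuples-cong : ∀ m {f g : Tuple m → ℕ} → (∀ b → f b ≡ g b) → sumTuples m f ≡ sumTuples m g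
sumTuples-cong m f≗g = cong sum (List.map-cong f≗g (allTuples m))

sumTuples-suc : ∀ m (f : Tuple (suc m) → ℕ) →
  sumTuples (suc m) f ≡ sumTuples m (f ∘ (false ∷_)) + sumTuples m (f ∘ (true ∷_))
sumTuples-suc m f = begin
  sum (List.map f (List.map (false ∷_) T List.++ List.map (true ∷_) T))
    ≡⟨ cong sum (List.map-++ f (List.map (false ∷_) T) (List.map (true ∷_) T)) ⟩
  sum (List.map f (List.map (false ∷_) T) List.++ List.map f (List.map (true ∷_) T))
    ≡⟨ sum-++ (List.map f (List.map (false ∷_) T)) _ ⟩
  sum (List.map f (List.map (false ∷_) T)) + sum (List.map f (List.map (true ∷_) T))
    ≡⟨ cong₂ _+_ (cong sum (sym (List.map-∘ T))) (cong sum (sym (List.map-∘ T))) ⟩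
  sumTuples m (f ∘ (false ∷_)) + sumTuples m (f ∘ (true ∷_)) ∎
  where
  open ≡-Reasoning
  T = allTuples m

sumTuples-∁ : ∀ m (f : Tuple m → ℕ) → sumTuples m (f ∘ ∁) ≡ sumTuples m f
sumTuples-∁ zero    f = refl
sumTuples-∁ (suc m) f = begin
  sumTuples (suc m) (f ∘ ∁)
    ≡⟨ sumTuples-suc m (f ∘ ∁) ⟩
  sumTuples m (f ∘ (true ∷_) ∘ ∁) + sumTuples m (f ∘ (false ∷_) ∘ ∁)
    ≡⟨ cong₂ _+_ (sumTuples-∁ m (f ∘ (true ∷_))) (sumTuples-∁ m (f ∘ (false ∷_))) ⟩
  sumTuples m (f ∘ (true ∷_)) + sumTuples m (f ∘ (false ∷_))
    ≡⟨ +-comm (sumTuples m (f ∘ (true ∷_))) _ ⟩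
  sumTuples m (f ∘ (false ∷_)) + sumTuples m (f ∘ (true ∷_))
    ≡⟨ sym (sumTuples-suc m f) ⟩
  sumTuples (suc m) f ∎
  where open ≡-Reasoning

countExt-∁ : ∀ n m (R : Rel (n + m)) → Invariant R → (a : Tuple n) → countExt m R (∁ a) ≡ countExt m R a
countExt-∁ n m R inv a = trans (sumTuples-cong m same) (sumTuples-∁ m (λ b → if R (a ++ b) then 1 else 0))
  where
  same : ∀ b → (if R (∁ a ++ b) then 1 else 0) ≡ (if R (a ++ ∁ b) then 1 else 0)
  same b = cong (λ x → if x then 1 else 0) (begin
    R (∁ a ++ b)       ≡⟨ cong (λ w → R (∁ a ++ w)) (sym (∁-involutive b)) ⟩
    R (∁ a ++ ∁ (∁ b)) ≡⟨ cong R (sym (map-++ not a (∁ b))) ⟩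
    R (∁ (a ++ ∁ b))   ≡⟨ inv (a ++ ∁ b) ⟩
    R (a ++ ∁ b)       ∎)
    where open ≡-Reasoning

closure-invariant : ∀ {Γ} → (∀ {n R} → Γ n R → Invariant R) → ∀ {n R} → MaxClosure Γ n R → Invariant R
closure-invariant inv-Γ (gen g) = inv-Γ g
closure-invariant inv-Γ eq      = EQ-invariant
closure-invariant inv-Γ (vars {R = R} σ c) v = trans (cong R (pull-∁ σ v)) (closure-invariant inv-Γ c (pull σ v))
closure-invariant inv-Γ (conj {n} {R = R} {S} c d) v =
  cong₂ _∧_ (trans (cong R (take-map not n v)) (closure-invariant inv-Γ c _))
            (trans (cong S (drop-map not n v)) (closure-invariant inv-Γ d _))
closure-invariant inv-Γ (maxImp {n} {m} {R} c) a =
  cong (_≡ᵇ maxExt n m R) (countExt-∁ n m R (closure-invariant inv-Γ c) a)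
closure-invariant inv-Γ (ext {R = R} {S} c R≗S) v =
  trans (sym (R≗S (∁ v))) (trans (closure-invariant inv-Γ c v) (R≗S v))

allTuples-complete : ∀ n (v : Tuple n) → v ∈ allTuples n
allTuples-complete zero    []          = here refl
allTuples-complete (suc n) (false ∷ v) = ∈-++⁺ˡ (∈-map⁺ (false ∷_) (allTuples-complete n v))
allTuples-complete (suc n) (true ∷ v)  =
  ∈-++⁺ʳ (List.map (false ∷_) (allTuples n)) (∈-map⁺ (true ∷_) (allTuples-complete n v))

∀-tuple? : ∀ n {P : Tuple n → Set} → (∀ v → Dec (P v)) → Dec (∀ v → P v)
∀-tuple? n P? = map′ (λ ps v → All.lookup ps (allTuples-complete n v))
                     (λ ps → All.tabulate (λ {v} _ → ps v))
                     (all? P? (allTuples n))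

∀-Bool? : {P : Bool → Set} → (∀ b → Dec (P b)) → Dec (∀ b → P b)
∀-Bool? P? = map′ (λ { (pf , pt) false → pf ; (pf , pt) true → pt }) (λ ps → ps false , ps true)
                  (P? false ×-dec P? true)

_≐?_ : ∀ {n} (R S : Rel n) → Dec (∀ v → R v ≡ S v)
R ≐? S = ∀-tuple? _ (λ v → R v ≟ᵇ S v)

indicator : Bool → ℕ
indicator b = if b then 1 else 0

foldr-⊔-least : ∀ {A : Set} (f : A → ℕ) M (L : List A) → (∀ x → f x ≤ M) →
  List.foldr _⊔_ 0 (List.map f L) ≤ M
foldr-⊔-least f M List.[]       f≤M = z≤n
foldr-⊔-least f M (x List.∷ L) f≤M = ⊔-lub (f≤M x) (foldr-⊔-least f M L f≤M)

foldr-⊔-upper : ∀ {A : Set} (f : A → ℕ) {x} {L : List A} → x ∈ L → f x ≤ List.foldr _⊔_ 0 (List.map f L)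
foldr-⊔-upper f (here refl)           = m≤m⊔n _ _
foldr-⊔-upper f {L = y List.∷ L} (there x∈L) = ≤-trans (foldr-⊔-upper f x∈L) (m≤n⊔m (f y) _)

-- If every tuple has at most one extension and exactly the tuples of S
-- have one, and S is nonempty, then max-implementation yields S: it acts as
-- an existential quantifier.
maxImpl-indicator : ∀ n m (R : Rel (n + m)) (S : Rel n) (a₀ : Tuple n) →
  (∀ a → countExt m R a ≡ indicator (S a)) → S a₀ ≡ true → ∀ a → maxImpl n m R a ≡ S a
maxImpl-indicator n m R S a₀ count S-a₀ a = begin
  countExt m R a ≡ᵇ maxExt n m R ≡⟨ cong₂ _≡ᵇ_ (count a) max≡1 ⟩
  indicator (S a) ≡ᵇ 1          ≡⟨ indicator-≡ᵇ1 (S a) ⟩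
  S a                           ∎
  where
  open ≡-Reasoning
  indicator-≤1 : ∀ b → indicator b ≤ 1
  indicator-≤1 true  = s≤s z≤n
  indicator-≤1 false = z≤n
  indicator-≡ᵇ1 : ∀ b → (indicator b ≡ᵇ 1) ≡ b
  indicator-≡ᵇ1 true  = refl
  indicator-≡ᵇ1 false = refl
  max≡1 : maxExt n m R ≡ 1
  max≡1 = ≤-antisym
    (foldr-⊔-least (countExt m R) 1 (allTuples n) (λ a → subst (_≤ 1) (sym (count a)) (indicator-≤1 (S a))))
    (subst (_≤ maxExt n m R) (trans (count a₀) (cong indicator S-a₀))
           (foldr-⊔-upper (countExt m R) (allTuples-complete n a₀)))

copair : ∀ {n m k} → (Fin n → Fin k) → (Fin m → Fin k) → Fin (n + m) → Fin k
copair {zero}  f g i       = g i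
copair {suc n} f g zero    = f zero
copair {suc n} f g (suc i) = copair (f ∘ suc) g i

copair-↑ʳ : ∀ n {m k} (f : Fin n → Fin k) (g : Fin m → Fin k) i → copair f g (n ↑ʳ i) ≡ g i
copair-↑ʳ zero    f g i = refl
copair-↑ʳ (suc n) f g i = copair-↑ʳ n (f ∘ suc) g i

pull-copair : ∀ {n m k} (f : Fin n → Fin k) (g : Fin m → Fin k) (v : Tuple k) →
  pull (copair f g) v ≡ pull f v ++ pull g v
pull-copair {zero}  f g v = refl
pull-copair {suc n} f g v = cong (lookup v (f zero) ∷_) (pull-copair (f ∘ suc) g v)

take-++ : ∀ {n m} (x : Tuple n) (y : Tuple m) → take n (x ++ y) ≡ x
take-++ {n} x y = ++-injectiveˡ (take n (x ++ y)) x (take++drop≡id n (x ++ y))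

drop-++ : ∀ {n m} (x : Tuple n) (y : Tuple m) → drop n (x ++ y) ≡ y
drop-++ {n} x y = ++-injectiveʳ (take n (x ++ y)) x (take++drop≡id n (x ++ y))

reindex-copair : ∀ {n m k} (f : Fin n → Fin k) (g : Fin m → Fin k) (A : Rel n) (B : Rel m) (v : Tuple k) →
  reindex (copair f g) (conjRel A B) v ≡ A (pull f v) ∧ B (pull g v)
reindex-copair {n} f g A B v = begin
  A (take n (pull (copair f g) v)) ∧ B (drop n (pull (copair f g) v))
    ≡⟨ cong (λ w → A (take n w) ∧ B (drop n w)) (pull-copair f g v) ⟩
  A (take n (pull f v ++ pull g v)) ∧ B (drop n (pull f v ++ pull g v))
    ≡⟨ cong₂ (λ x y → A x ∧ B y) (take-++ (pull f v) (pull g v)) (drop-++ (pull f v) (pull g v)) ⟩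
  A (pull f v) ∧ B (pull g v) ∎
  where open ≡-Reasoning

Surjective : ∀ {N n} → (Fin N → Fin n) → Set
Surjective {N} σ = ∀ j → ∃ λ (i : Fin N) → σ i ≡ j

eqTuple-pull : ∀ {N n} (σ : Fin N → Fin n) → Surjective σ → (v q : Tuple n) →
  eqTuple (pull σ v) (pull σ q) ≡ eqTuple v q
eqTuple-pull σ onto v q = ⇔→≡ {z = true} (mk⇔ reflect preserve)
  where
  agree : pull σ v ≡ pull σ q → ∀ j → lookup v j ≡ lookup q j
  agree e j with onto j
  ... | i , refl = trans (sym (lookup∘tabulate (lookup v ∘ σ) i))
                         (trans (cong (λ w → lookup w i) e) (lookup∘tabulate (lookup q ∘ σ) i))
  reflect : eqTuple (pull σ v) (pull σ q) ≡ true → eqTuple v q ≡ true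
  reflect e = subst (λ w → eqTuple v w ≡ true)
    (trans (sym (tabulate∘lookup v)) (trans (tabulate-cong (agree (eqTuple-sound (pull σ v) (pull σ q) e))) (tabulate∘lookup q)))
    (eqTuple-refl v)
  preserve : eqTuple v q ≡ true → eqTuple (pull σ v) (pull σ q) ≡ true
  preserve e = subst (λ w → eqTuple (pull σ v) (pull σ w) ≡ true) (eqTuple-sound v q e) (eqTuple-refl (pull σ v))

reindex-Excl : ∀ {N n} (σ : Fin N → Fin n) → Surjective σ → (p v : Tuple n) →
  reindex σ (Excl (pull σ p)) v ≡ Excl p v
reindex-Excl σ onto p v = begin
  not (eqTuple (pull σ v) (pull σ p)) ∧ not (eqTuple (pull σ v) (∁ (pull σ p)))
    ≡⟨ cong (λ w → not (eqTuple (pull σ v) (pull σ p)) ∧ not (eqTuple (pull σ v) w)) (sym (pull-∁ σ p)) ⟩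
  not (eqTuple (pull σ v) (pull σ p)) ∧ not (eqTuple (pull σ v) (pull σ (∁ p)))
    ≡⟨ cong₂ (λ x y → not x ∧ not y) (eqTuple-pull σ onto v p) (eqTuple-pull σ onto v (∁ p)) ⟩
  Excl p v ∎
  where open ≡-Reasoning

tabulate-const : ∀ {n} {f : Fin n → Bool} (b : Bool) → (∀ i → f i ≡ b) → tabulate f ≡ replicate n b
tabulate-const {n} b f≡b = trans (tabulate-cong f≡b) (trans (tabulate-∘ (const b) id) (map-const (tabulate id) b))

module Constructions {Γ : (n : ℕ) → Rel n → Set} where

  C : (n : ℕ) → Rel n → Set
  C = MaxClosure Γ

  ext-by-enumeration : ∀ {n} {R S : Rel n} → C n R → {True (R ≐? S)} → C n S
  ext-by-enumeration c {ok} = ext c (toWitness ok)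

  -- The full relation: ∃max over both variables of EQ is the true 0-ary
  -- relation, padded with dummy variables.
  full : ∀ n → C n (λ _ → true)
  full n = ext (vars {n = 0} (λ ()) (maxImp {n = 0} {m = 2} eq)) (λ v → refl)

  conjSame : ∀ {n} {R S : Rel n} → C n R → C n S → C n (λ v → R v ∧ S v)
  conjSame {R = R} {S} c d = ext (vars (copair id id) (conj c d)) (λ v →
    trans (reindex-copair id id R S v) (cong₂ (λ x y → R x ∧ S y) (tabulate∘lookup v) (tabulate∘lookup v)))

  ⋀ : ∀ {A : Set} {n} → (A → Rel n) → List A → Rel n
  ⋀ T List.[]       v = true
  ⋀ T (a List.∷ L) v = T a v ∧ ⋀ T L v

  ⋀-closed : ∀ {A : Set} {n} {T : A → Rel n} → (∀ a → C n (T a)) → ∀ L → C n (⋀ T L)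
  ⋀-closed {n = n} T-closed List.[]       = full n
  ⋀-closed T-closed (a List.∷ L) = conjSame (T-closed a) (⋀-closed T-closed L)

  ⋀-true : ∀ {A : Set} {n} (T : A → Rel n) {v} → (∀ a → T a v ≡ true) → ∀ L → ⋀ T L v ≡ true
  ⋀-true T Tv List.[]       = refl
  ⋀-true T Tv (a List.∷ L) = cong₂ _∧_ (Tv a) (⋀-true T Tv L)

  ⋀-false : ∀ {A : Set} {n} (T : A → Rel n) {v a L} → a ∈ L → T a v ≡ false → ⋀ T L v ≡ false
  ⋀-false T (here refl) Tav rewrite Tav = refl
  ⋀-false T {v} {L = b List.∷ L} (there a∈L) Tav rewrite ⋀-false T a∈L Tav = ∧-comm (T b v) false

-- Step 1: NAE₃ from Compl_{k,ℓ}

module FromCompl {Γ : (n : ℕ) → Rel n → Set} where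
  open Constructions {Γ}

  -- ∃max y of Excl (0,0,b)(v₁,v₂,y): equal v₁,v₂ have one extension, different
  -- ones have two, so this is the disequality relation Excl (0,0).
  neqFrom : ∀ b → C 3 (Excl (false ∷ false ∷ b ∷ [])) → C 2 (Excl (false ∷ false ∷ []))
  neqFrom true  c = ext-by-enumeration (maxImp {n = 2} {m = 1} c)
  neqFrom false c = ext-by-enumeration (maxImp {n = 2} {m = 1} c)

  -- NAE₃ (v₁,v₂,v₃) ⇔ ∃ y. Excl (0,0,1)(v₁,v₂,y) ∧ y ≠ v₃, with y unique.
  nae₃From : ∀ b → C 3 (Excl (false ∷ false ∷ b ∷ [])) → C 3 NAE₃
  nae₃From false c = ext c (Excl-∁ (true ∷ true ∷ true ∷ []))
  nae₃From true  c = ext-by-enumeration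
    (maxImp {n = 3} {m = 1} (vars (lookup (# 0 ∷ # 1 ∷ # 3 ∷ # 3 ∷ # 2 ∷ [])) (conj c (neqFrom true c))))

  identify : ∀ k l (p : Tuple 3) (f : Fin k → Fin 3) (g : Fin l → Fin 3) →
    (∀ i → lookup p (f i) ≡ false) → (∀ i → lookup p (g i) ≡ true) → Surjective (copair f g) →
    C (k + l) (Compl k l) → C 3 (Excl p)
  identify k l p f g p∘f≡0 p∘g≡1 onto c =
    ext (vars (copair f g) (ext c (λ v → trans (Compl-Excl k l v) (cong (λ w → Excl w v) zerosOnes))))
        (reindex-Excl (copair f g) onto p)
    where
    zerosOnes : replicate k false ++ replicate l true ≡ pull (copair f g) p
    zerosOnes = sym (trans (pull-copair f g p) (cong₂ _++_ (tabulate-const false p∘f≡0) (tabulate-const true p∘g≡1)))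

  collapse₃ : ∀ {r} → Fin (3 + r) → Fin 3
  collapse₃ zero          = # 0
  collapse₃ (suc zero)    = # 1
  collapse₃ (suc (suc _)) = # 2

  collapse₂ : ∀ {r} → Fin (2 + r) → Fin 3
  collapse₂ zero    = # 0
  collapse₂ (suc _) = # 1

  -- Compl_{0,ℓ} = Excl (1ˡ) collapses to Excl (111) = NAE₃.
  fromOnes : ∀ l → C (3 + l) (Compl 0 (3 + l)) → C 3 NAE₃
  fromOnes l = identify 0 _ _ (λ ()) collapse₃ (λ ()) (λ i → lookup-replicate (collapse₃ i) true) onto
    where
    onto : Surjective (copair {0} (λ ()) (collapse₃ {l}))
    onto zero             = # 0 , refl
    onto (suc zero)       = # 1 , refl
    onto (suc (suc zero)) = # 2 , refl

  -- Compl_{k,0} = Excl (0ᵏ) collapses to Excl (000).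
  fromZeros : ∀ k → C (3 + k + 0) (Compl (3 + k) 0) → C 3 NAE₃
  fromZeros k c = nae₃From false
    (identify _ 0 _ collapse₃ (λ ()) (λ i → lookup-replicate (collapse₃ i) false) (λ ()) onto c)
    where
    onto : Surjective (copair (collapse₃ {k}) (λ ()))
    onto zero             = # 0 , refl
    onto (suc zero)       = # 1 , refl
    onto (suc (suc zero)) = # 2 , refl

  -- Compl_{1,ℓ} = Excl (01ˡ) collapses to Excl (110) = Excl (001).
  fromOneZero : ∀ l → C (1 + (2 + l)) (Compl 1 (2 + l)) → C 3 NAE₃
  fromOneZero l c = nae₃From true
    (ext (identify 1 _ (true ∷ true ∷ false ∷ []) (λ _ → # 2) collapse₂ (λ _ → refl) ones onto c)
         (Excl-∁ (false ∷ false ∷ true ∷ [])))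
    where
    ones : ∀ i → lookup (true ∷ true ∷ false ∷ []) (collapse₂ i) ≡ true
    ones zero    = refl
    ones (suc _) = refl
    onto : Surjective (copair {1} (λ _ → # 2) (collapse₂ {l}))
    onto zero             = # 1 , refl
    onto (suc zero)       = # 2 , refl
    onto (suc (suc zero)) = # 0 , refl

  -- Compl_{k,ℓ} = Excl (0ᵏ1ˡ) with k ≥ 2, ℓ ≥ 1 collapses to Excl (001).
  fromZerosOnes : ∀ k l → C (2 + k + (1 + l)) (Compl (2 + k) (1 + l)) → C 3 NAE₃
  fromZerosOnes k l c = nae₃From true
    (identify _ _ (false ∷ false ∷ true ∷ []) collapse₂ (λ _ → # 2) zeros (λ _ → refl) onto c)
    where
    zeros : ∀ i → lookup (false ∷ false ∷ true ∷ []) (collapse₂ i) ≡ false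
    zeros zero    = refl
    zeros (suc _) = refl
    onto : Surjective (copair (collapse₂ {k}) (λ (_ : Fin (1 + l)) → # 2))
    onto zero             = # 0 , refl
    onto (suc zero)       = # 1 , refl
    onto (suc (suc zero)) = 2 + k ↑ʳ # 0 , copair-↑ʳ (2 + k) collapse₂ (λ _ → # 2) (# 0)

  nae₃FromCompl : ∀ k l → 3 ≤ k + l → C (k + l) (Compl k l) → C 3 NAE₃
  nae₃FromCompl zero                zero                ()
  nae₃FromCompl zero                (suc zero)          (s≤s ())
  nae₃FromCompl zero                (suc (suc zero))    (s≤s (s≤s ()))
  nae₃FromCompl (suc zero)          zero                (s≤s ())
  nae₃FromCompl (suc zero)          (suc zero)          (s≤s (s≤s ()))
  nae₃FromCompl (suc (suc zero))    zero                (s≤s (s≤s ()))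
  nae₃FromCompl zero                (suc (suc (suc l))) _ = fromOnes l
  nae₃FromCompl (suc (suc (suc k))) zero                _ = fromZeros k
  nae₃FromCompl (suc zero)          (suc (suc l))       _ = fromOneZero l
  nae₃FromCompl (suc (suc k))       (suc l)             _ = fromZerosOnes k l

-- Step 2: every Excl a (a nonempty) from NAE₃

-- Lit b (v, y) = Excl (0, b)(v, y): y = v when b = 1 and y = ∁ v when b = 0.
Lit : Bool → Rel 2
Lit b = Excl (false ∷ b ∷ [])

-- Excl p (v) ⇔ ∃ y. NAE₃ (y) ∧ ⋀ᵢ Lit pᵢ (vᵢ, yᵢ): the literals force
-- yᵢ = [vᵢ = pᵢ], which is constant exactly when v ∈ {p, ∁ p}.
flipVars : Fin 9 → Fin 6
flipVars = lookup (# 3 ∷ # 4 ∷ # 5 ∷ # 0 ∷ # 3 ∷ # 1 ∷ # 4 ∷ # 2 ∷ # 5 ∷ [])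

flipGadget : Tuple 3 → Rel 6
flipGadget (p₁ ∷ p₂ ∷ p₃ ∷ []) =
  reindex flipVars (conjRel (conjRel (conjRel NAE₃ (Lit p₁)) (Lit p₂)) (Lit p₃))

flipGadget-spec : ∀ p v → maxImpl 3 3 (flipGadget p) v ≡ Excl p v
flipGadget-spec = from-yes (∀-tuple? 3 λ p → maxImpl 3 3 (flipGadget p) ≐? Excl p)

-- Pin (c₁,c₂,c₃)(y, z₁, z₂, z₃): three 3-clauses which, together with
-- Excl (1, c₃, a)(y, z₃, x), determine y from (z, x).
pinClauseVars : Fin 9 → Fin 4
pinClauseVars = lookup (# 0 ∷ # 1 ∷ # 2 ∷ # 0 ∷ # 1 ∷ # 3 ∷ # 0 ∷ # 2 ∷ # 3 ∷ [])

Pin : Tuple 3 → Rel 4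
Pin (c₁ ∷ c₂ ∷ c₃ ∷ []) =
  reindex pinClauseVars (conjRel (conjRel (Excl (false ∷ c₁ ∷ c₂ ∷ []))
                            (Excl (false ∷ c₁ ∷ not c₃ ∷ [])))
                   (Excl (false ∷ c₂ ∷ not c₃ ∷ [])))

-- The arity-lowering gadget as a function of y, with the tail x of the tuple
-- seen through the flags E = [x = a], E' = [x = ∁ a].
lowering : Tuple 3 → Tuple 3 → Bool → Bool → Bool → Bool
lowering c@(_ ∷ _ ∷ c₃ ∷ []) (z₁ ∷ z₂ ∷ z₃ ∷ []) E E' y =
  ExclOn (true ∷ c₃ ∷ []) (y ∷ z₃ ∷ []) E E' ∧ Pin c (y ∷ z₁ ∷ z₂ ∷ z₃ ∷ [])

-- The number of extensions y ∈ {0, 1}, written as countExt 1 computes it.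
loweringCount : Tuple 3 → Tuple 3 → Bool → Bool → ℕ
loweringCount c z E E' = indicator (lowering c z E E' false) + (indicator (lowering c z E E' true) + 0)

loweringCount-spec : ∀ c z E E' → E ∧ E' ≡ false → loweringCount c z E E' ≡ indicator (ExclOn c z E E')
loweringCount-spec = from-yes
  (∀-tuple? 3 λ c → ∀-tuple? 3 λ z → ∀-Bool? λ E → ∀-Bool? λ E' →
    (E ∧ E' ≟ᵇ false) →-dec (loweringCount c z E E' ≟ℕ indicator (ExclOn c z E E')))

-- The arity-lowering gadget on variables (z₁, z₂, z₃, x, y):
--   Excl (1, c₃, a)(y, z₃, x) ∧ Pin c (y, z₁, z₂, z₃).
-- Each (z, x) has at most one extension y, and has one exactly when
-- (z, x) ∈ Excl (c ++ a).
module Lowering (j : ℕ) (c₁ c₂ c₃ : Bool) (a : Tuple (suc j)) where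

  private
    N = suc j
    cs = c₁ ∷ c₂ ∷ c₃ ∷ []

    y : Fin (3 + N + 1)
    y = 3 + N ↑ʳ # 0

    headVars : Fin 2 → Fin (3 + N + 1)
    headVars = lookup (y ∷ # 2 ∷ [])

    tailVars : Fin N → Fin (3 + N + 1)
    tailVars i = (3 ↑ʳ i) ↑ˡ 1

    pinVars : Fin 4 → Fin (3 + N + 1)
    pinVars = lookup (y ∷ # 0 ∷ # 1 ∷ # 2 ∷ [])

  lowerVars : Fin (2 + N + 4) → Fin (3 + N + 1)
  lowerVars = copair (copair headVars tailVars) pinVars

  Lowered : Rel (3 + N + 1)
  Lowered = reindex lowerVars (conjRel (Excl (true ∷ c₃ ∷ a)) (Pin cs))

  Lowered-value : ∀ z₁ z₂ z₃ x b → Lowered ((z₁ ∷ z₂ ∷ z₃ ∷ x) ++ b ∷ [])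
                                 ≡ lowering cs (z₁ ∷ z₂ ∷ z₃ ∷ []) (eqTuple x a) (eqTuple x (∁ a)) b
  Lowered-value z₁ z₂ z₃ x b = begin
    Lowered w
      ≡⟨ reindex-copair (copair headVars tailVars) pinVars (Excl (true ∷ c₃ ∷ a)) (Pin cs) w ⟩
    Excl (true ∷ c₃ ∷ a) (pull (copair headVars tailVars) w) ∧ Pin cs (pull pinVars w)
      ≡⟨ cong₂ (λ u t → Excl (true ∷ c₃ ∷ a) u ∧ Pin cs (t ∷ z₁ ∷ z₂ ∷ z₃ ∷ []))
               (trans (pull-copair headVars tailVars w) (cong₂ (λ t s → (t ∷ z₃ ∷ []) ++ s) y↦b tail↦x))
               y↦b ⟩
    Excl ((true ∷ c₃ ∷ []) ++ a) ((b ∷ z₃ ∷ []) ++ x) ∧ Pin cs (b ∷ z₁ ∷ z₂ ∷ z₃ ∷ [])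
      ≡⟨ cong (_∧ Pin cs (b ∷ z₁ ∷ z₂ ∷ z₃ ∷ [])) (Excl-++ (true ∷ c₃ ∷ []) (b ∷ z₃ ∷ []) a x) ⟩
    lowering cs (z₁ ∷ z₂ ∷ z₃ ∷ []) (eqTuple x a) (eqTuple x (∁ a)) b ∎
    where
    open ≡-Reasoning
    w = (z₁ ∷ z₂ ∷ z₃ ∷ x) ++ b ∷ []
    y↦b : lookup w y ≡ b
    y↦b = lookup-++ʳ (z₁ ∷ z₂ ∷ z₃ ∷ x) (b ∷ []) (# 0)
    tail↦x : pull tailVars w ≡ x
    tail↦x = trans (tabulate-cong (λ i → lookup-++ˡ (z₁ ∷ z₂ ∷ z₃ ∷ x) (b ∷ []) (3 ↑ʳ i))) (tabulate∘lookup x)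

  Lowered-count : ∀ v → countExt 1 Lowered v ≡ indicator (Excl (c₁ ∷ c₂ ∷ c₃ ∷ a) v)
  Lowered-count (z₁ ∷ z₂ ∷ z₃ ∷ x) = begin
    countExt 1 Lowered (z₁ ∷ z₂ ∷ z₃ ∷ x)
      ≡⟨ cong₂ (λ s t → indicator s + (indicator t + 0)) (Lowered-value z₁ z₂ z₃ x false) (Lowered-value z₁ z₂ z₃ x true) ⟩
    loweringCount cs zs (eqTuple x a) (eqTuple x (∁ a))
      ≡⟨ loweringCount-spec cs zs _ _ (eqTuple-notBoth x a) ⟩
    indicator (ExclOn cs zs (eqTuple x a) (eqTuple x (∁ a)))
      ≡⟨ cong indicator (sym (Excl-++ cs zs a x)) ⟩
    indicator (Excl (c₁ ∷ c₂ ∷ c₃ ∷ a) (z₁ ∷ z₂ ∷ z₃ ∷ x)) ∎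
    where
    open ≡-Reasoning
    zs = z₁ ∷ z₂ ∷ z₃ ∷ []

module FromNAE₃ {Γ : (n : ℕ) → Rel n → Set} (nae : MaxClosure Γ 3 NAE₃) where
  open Constructions {Γ}
  open FromCompl {Γ} using (neqFrom)

  -- EQ is Lit 1, and Lit 0 is the disequality obtained from NAE₃ = Excl (000).
  lit : ∀ b → C 2 (Lit b)
  lit true  = ext-by-enumeration eq
  lit false = neqFrom false (ext nae (λ v → sym (Excl-∁ (true ∷ true ∷ true ∷ []) v)))

  -- Excl (b) is empty: identify both variables of the disequality.
  excl₁ : ∀ p → C 1 (Excl p)
  excl₁ (true ∷ [])  = ext-by-enumeration (vars (λ _ → # 0) (lit false))
  excl₁ (false ∷ []) = ext-by-enumeration (vars (λ _ → # 0) (lit false))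

  -- Excl (0, b) = Lit b, and Excl (1, b) = Excl (0, ¬ b).
  excl₂ : ∀ p → C 2 (Excl p)
  excl₂ (false ∷ b ∷ []) = lit b
  excl₂ (true ∷ b ∷ [])  = ext (lit (not b)) (Excl-∁ (true ∷ b ∷ []))

  excl₃ : ∀ p → C 3 (Excl p)
  excl₃ p@(p₁ ∷ p₂ ∷ p₃ ∷ []) =
    ext (maxImp {n = 3} {m = 3}
          (vars flipVars (conj (conj (conj nae (lit p₁)) (lit p₂)) (lit p₃))))
        (flipGadget-spec p)

  lowerArity : ∀ j c₁ c₂ c₃ (a : Tuple (suc j)) →
    C (2 + suc j) (Excl (true ∷ c₃ ∷ a)) → C (3 + suc j) (Excl (c₁ ∷ c₂ ∷ c₃ ∷ a))
  lowerArity j c₁ c₂ c₃ a c =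
    ext (maxImp {n = 3 + suc j} {m = 1} (vars lowerVars (conj c pin)))
        (maxImpl-indicator _ 1 Lowered (Excl (c₁ ∷ c₂ ∷ c₃ ∷ a)) (not c₁ ∷ c₂ ∷ c₃ ∷ a)
                           Lowered-count (Excl-flipHead c₁ (c₂ ∷ c₃ ∷ a)))
    where
    open Lowering j c₁ c₂ c₃ a
    pin : C 4 (Pin (c₁ ∷ c₂ ∷ c₃ ∷ []))
    pin = vars pinClauseVars (conj (conj (excl₃ _) (excl₃ _)) (excl₃ _))

  exclAll : ∀ n (a : Tuple (suc n)) → C (suc n) (Excl a)
  exclAll zero                a = excl₁ a
  exclAll (suc zero)          a = excl₂ a
  exclAll (suc (suc zero))    a = excl₃ a
  exclAll (suc (suc (suc j))) (c₁ ∷ c₂ ∷ c₃ ∷ a) =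
    lowerArity j c₁ c₂ c₃ a (exclAll (suc (suc j)) (true ∷ c₃ ∷ a))

-- Step 3: every invariant relation lies in the closure

module Representation {Γ : (n : ℕ) → Rel n → Set} (nae : MaxClosure Γ 3 NAE₃) where
  open Constructions {Γ}
  open FromNAE₃ nae using (exclAll)

  -- The constraint contributed by the tuple a: none if a ∈ R, else a, ∁ a ∉ R.
  guard : ∀ {n} → Rel n → Tuple n → Rel n
  guard R a = if R a then (λ _ → true) else Excl a

  -- guard R a is in the closure; for invariant R, the conjunction of all
  -- guard R a accepts every v ∈ R and rejects every v ∉ R through guard R v.
  guard-closed : ∀ {n} (R : Rel (suc n)) a → C (suc n) (guard R a)
  guard-closed {n} R a with R a
  ... | true  = full (suc n)
  ... | false = exclAll n a

  guard-accepts : ∀ {n} {R : Rel n} → Invariant R → ∀ {v} → R v ≡ true → ∀ a → guard R a v ≡ true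
  guard-accepts {R = R} inv {v} Rv a with R a in Ra
  ... | true  = refl
  ... | false = Excl-outside a v (λ { refl → true≢false (trans (sym Rv) Ra) })
                                 (λ { refl → true≢false (trans (sym Rv) (trans (inv a) Ra)) })
    where
    true≢false : true ≡ false → ⊥
    true≢false ()

  guard-rejects : ∀ {n} (R : Rel n) {v} → R v ≡ false → guard R v v ≡ false
  guard-rejects R {v} Rv rewrite Rv = Excl-self v

  represent : ∀ {n} (R : Rel (suc n)) → Invariant R → C (suc n) R
  represent {n} R inv = ext (⋀-closed (guard-closed R) (allTuples (suc n))) same
    where
    same : ∀ v → ⋀ (guard R) (allTuples (suc n)) v ≡ R v
    same v with R v in Rv
    ... | true  = ⋀-true (guard R) (guard-accepts inv Rv) (allTuples (suc n))
    ... | false = ⋀-false (guard R) (allTuples-complete (suc n) v) (guard-rejects R Rv)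

Compl-invariant : ∀ {k l n R} → IsCompl k l n R → Invariant R
Compl-invariant {k} {l} here v = begin
  Compl k l (∁ v)      ≡⟨ Compl-Excl k l (∁ v) ⟩
  Excl zerosOnes (∁ v) ≡⟨ Excl-invariant zerosOnes v ⟩
  Excl zerosOnes v     ≡⟨ sym (Compl-Excl k l v) ⟩
  Compl k l v          ∎
  where
  open ≡-Reasoning
  zerosOnes = replicate k false ++ replicate l true

lemma33 : (k l : ℕ) → 3 ≤ k + l →
    (n : ℕ) (R : Rel (suc n)) → MaxClosure (IsCompl k l) (suc n) R ⇔ SelfComplement R
lemma33 k l k+l≥3 n R = mk⇔
  (λ c → invariant⇒selfComplement (closure-invariant Compl-invariant c))
  (λ sc → Representation.represent nae R (selfComplement⇒invariant sc))
  where
  nae : MaxClosure (IsCompl k l) 3 NAE₃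
  nae = FromCompl.nae₃FromCompl k l k+l≥3 (gen here)
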